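{- For all integers $n\geq 0$ and $j\in\mathbb{Z}$, $$(n+2+3j)\,(w_n,t^{ -j})=(n+2-3j)\,(w_n,t^{j}),$$ where $(w_n,t^j)$ denotes the coefficient of $t^j$ in $w_n(t)$.
   Context: For $n\geq 0$ let $P_n$ be a strictly convex polygon with $n+2$ vertices and a marked boundary edge $e_*$. A triangulation of $P_n$ is a decomposition into $n$ non-overlapping triangles with vertices among those of $P_n$. For $n\geq1$, its checkerboard colouring colours each triangle black or white such that the unique triangle containing $e_*$ is black and triangles sharing an edge have different colours; $n_b(\tau),n_w(\tau)$ denote the numbers of black and white triangles of $\tau$. Define the Laurent polynomial $w_n(t)=\sum_{\tau}t^{n_b(\tau)-n_w(\tau)}\in\mathbb{N}[t,t^{ -1}]$, the sum over all triangulations $\tau$ of $P_n$, with $w_0(t)=1$. -}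

module Defs where

open import Data.Nat using (ℕ; zero; suc; _+_)
open import Data.Integer using (ℤ; +_; _-_)
open import Data.Bool using (Bool; true; false; not)
open import Data.Fin using (Fin)
open import Data.Product using (Σ)
open import Function.Bundles using (_↔_)
open import Relation.Binary.PropositionalEquality using (_≡_)

-- Convex polygon with vertices labelled 0,1,…,n+1 in cyclic order.
-- A triangulation of the sub-polygon spanned by the consecutive vertices
-- i, i+1, …, j, with marked edge (i , j):
--  * if j = i+1 the "polygon" is just the edge (i , i+1): no triangles;
--  * otherwise the unique triangle containing (i , j) is (i , k , j) with
--    i < k < j, and the rest is a triangulation of the polygons i..k
--    (marked edge (i , k)) and k..j (marked edge (k , j)).
data Tri : ℕ → ℕ → Set where
  edge : ∀ {i} → Tri i (suc i)
  glue : ∀ {i k j} → Tri i k → Tri k j → Tri i j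

-- Triangulations of P_n (n+2 vertices 0..n+1), marked edge e_* = (0 , n+1).
Triangulation : ℕ → Set
Triangulation n = Tri 0 (suc n)

-- Checkerboard colouring (true = black, false = white).
-- The top triangle (i,k,j) gets colour c; the triangles sharing an edge with
-- it are exactly the top triangles of the two sub-triangulations (across the
-- diagonals (i,k) and (k,j)), so they get colour (not c).
-- nBlack c τ / nWhite c τ count black / white triangles when the top
-- triangle of τ has colour c.
nBlack : ∀ {i j} → Bool → Tri i j → ℕ
nWhite : ∀ {i j} → Bool → Tri i j → ℕ
nBlack c edge = 0
nBlack true  (glue l r) = suc (nBlack false l + nBlack false r)
nBlack false (glue l r) = nBlack true l + nBlack true r
nWhite c edge = 0
nWhite true  (glue l r) = nWhite false l + nWhite false r
nWhite false (glue l r) = suc (nWhite true l + nWhite true r)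

-- n_b(τ) and n_w(τ): the triangle containing e_* is black.
n-b n-w : ∀ {n} → Triangulation n → ℕ
n-b τ = nBlack true τ
n-w τ = nWhite true τ

-- exponent of t contributed by τ in w_n(t)
expo : ∀ {n} → Triangulation n → ℤ
expo τ = + n-b τ - + n-w τ

-- (w_n , t^j) = c : the number of triangulations τ of P_n with
-- n_b(τ) - n_w(τ) = j equals c (witnessed by a bijection with Fin c).
CoeffIs : ℕ → ℤ → ℕ → Set
CoeffIs n j c = Fin c ↔ Σ (Triangulation n) (λ τ → expo τ ≡ j)

module Submission where

-- A triangulation of P_n is the same as a binary tree with n internal
-- nodes (the triangle on the marked edge is the root, the two
-- sub-triangulations are its subtrees), and n_b - n_w becomes the
-- "excess" of the tree: excess leaf = 0, excess (node l r) =
-- 1 - excess l - excess r.  Counting leaves by the parity of their depth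
-- gives 2·#(even-depth leaves) = n + 2 - 3·excess, so if b trees have
-- excess j, then 2·|M(n,j)| = (n + 2 - 3j)·b, where M(n,j) is the set of
-- such trees with a marked leaf at even depth.  Finally re-hanging a tree
-- from its marked leaf (reversing the zipper of the path to that leaf)
-- is an involution preserving size and even depth and negating the
-- excess, so |M(n,-j)| = |M(n,j)|, which is the theorem.  (M(n,j) is
-- PointedTrees n j below.)

open import Defs
open import Data.Nat using (ℕ)
open import Data.Integer using (ℤ; +_; _+_; _-_; _*_; -_)
open import Relation.Binary.PropositionalEquality using (_≡_)

open import Axiom.UniquenessOfIdentityProofs.WithK using (uip)
open import Algebra.Properties.CommutativeSemigroup using (interchange)
open import Data.Bool using (Bool; true; false; not; if_then_else_)
open import Data.Bool.Properties using (not-involutive)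
open import Data.Empty using (⊥-elim)
open import Data.Fin using (Fin)
open import Data.Fin.Permutation using (↔⇒≡)
import Data.Fin.Properties as Finₚ
import Data.Integer.Properties as ℤₚ
open import Data.Integer.Tactic.RingSolver using (solve-∀)
open import Data.List using (List; []; _∷_; _++_; map; reverse; length)
open import Data.List.Properties
  using (unfold-reverse; reverse-involutive; length-reverse; reverse-map; length-map; map-∘; map-id; map-cong)
open import Data.List.Relation.Binary.Permutation.Propositional.Properties using (↭-reverse)
open import Data.Nat using (zero; suc)
import Data.Nat as ℕ
import Data.Nat.Properties as ℕₚ
open import Data.Nat.ListAction using (sum)
open import Data.Nat.ListAction.Properties using (sum-↭)
open import Data.Product using (Σ; _×_; _,_; proj₁; proj₂)
open import Data.Product.Function.Dependent.Propositional using (Σ-↔)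
open import Data.Product.Function.NonDependent.Propositional using (_×-↔_)
open import Data.Product.Properties using (Σ-≡,≡←≡)
open import Data.Sum using (_⊎_; inj₁; inj₂)
open import Data.Sum.Function.Propositional using (_⊎-↔_)
open import Function using (_∘_)
open import Function.Bundles using (_↔_; mk↔ₛ′; Inverse)
open import Function.Properties.Inverse using (↔-refl; ↔-sym; ↔-trans)
open import Function.Related.TypeIsomorphisms using (Σ-assoc)
open import Relation.Binary.PropositionalEquality
  using (refl; sym; trans; cong; cong₂; subst; module ≡-Reasoning)
open import Relation.Nullary using (¬_)

open ≡-Reasoning

Σ-≡-prop : ∀ {A : Set} {B : A → Set} → (∀ {x} (u v : B x) → u ≡ v) →
  ∀ {x x′ u v} → x ≡ x′ → _≡_ {A = Σ A B} (x , u) (x′ , v)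
Σ-≡-prop irrelevant refl = cong (_ ,_) (irrelevant _ _)

≡-prop↔ : ∀ {A B : Set} {x y : A} {u v : B} →
  (x ≡ y → u ≡ v) → (u ≡ v → x ≡ y) → (x ≡ y) ↔ (u ≡ v)
≡-prop↔ f g = mk↔ₛ′ f g (λ _ → uip _ _) (λ _ → uip _ _)

isEven : ℕ → Bool
isEven zero    = true
isEven (suc n) = not (isEven n)

signed : Bool → ℤ → ℤ
signed true  z = z
signed false z = - z

signed-not : ∀ b z → signed (not b) z ≡ - signed b z
signed-not true  z = refl
signed-not false z = sym (ℤₚ.neg-involutive z)

signed-minus : ∀ b x y → signed b (x - y) ≡ signed b x - signed b y
signed-minus true  x y = refl
signed-minus false x y = neg-minus x y
  where
  neg-minus : ∀ x y → - (x - y) ≡ - x - - y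
  neg-minus = solve-∀

alt : List ℤ → ℤ
alt []       = + 0
alt (x ∷ xs) = x - alt xs

alt-++ : ∀ xs ys → alt (xs ++ ys) ≡ alt xs + signed (isEven (length xs)) (alt ys)
alt-++ []       ys = sym (ℤₚ.+-identityˡ (alt ys))
alt-++ (x ∷ xs) ys = begin
  x - alt (xs ++ ys)                ≡⟨ cong (λ z → x - z) (alt-++ xs ys) ⟩
  x - (alt xs + signed p (alt ys))  ≡⟨ regroup x (alt xs) (signed p (alt ys)) ⟩
  (x - alt xs) + - signed p (alt ys) ≡⟨ cong (λ z → (x - alt xs) + z) (sym (signed-not p (alt ys))) ⟩
  (x - alt xs) + signed (not p) (alt ys) ∎
  where
  p : Bool
  p = isEven (length xs)
  regroup : ∀ a b c → a - (b + c) ≡ (a - b) + - c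
  regroup = solve-∀

alt-reverse : ∀ xs → alt (reverse xs) ≡ - signed (isEven (length xs)) (alt xs)
alt-reverse []       = refl
alt-reverse (x ∷ xs) = begin
  alt (reverse (x ∷ xs))                            ≡⟨ cong alt (unfold-reverse x xs) ⟩
  alt (reverse xs ++ x ∷ [])                        ≡⟨ alt-++ (reverse xs) (x ∷ []) ⟩
  alt (reverse xs) + signed (isEven (length (reverse xs))) (x - + 0)
    ≡⟨ cong₂ _+_ (alt-reverse xs) (cong (λ m → signed (isEven m) (x - + 0)) (length-reverse xs)) ⟩
  - signed p (alt xs) + signed p (x - + 0)          ≡⟨ cong (λ z → - signed p (alt xs) + signed p z) (ℤₚ.+-identityʳ x) ⟩
  - signed p (alt xs) + signed p x                  ≡⟨ ℤₚ.+-comm (- signed p (alt xs)) (signed p x) ⟩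
  signed p x - signed p (alt xs)                    ≡⟨ signed-minus p x (alt xs) ⟨
  signed p (x - alt xs)                             ≡⟨ ℤₚ.neg-involutive _ ⟨
  - - signed p (x - alt xs)                         ≡⟨ cong -_ (signed-not p (x - alt xs)) ⟨
  - signed (not p) (x - alt xs)                     ∎
  where
  p : Bool
  p = isEven (length xs)

data Tree : Set where
  leaf : Tree
  node : Tree → Tree → Tree

size : Tree → ℕ
size leaf       = 0
size (node l r) = suc (size l ℕ.+ size r)

-- (#black - #white) internal nodes when the root is black and colours
-- alternate along edges
excess : Tree → ℤ
excess leaf       = + 0
excess (node l r) = + 1 - excess l - excess r

-- leaves b t: the number of leaves of t at even (b = true) or odd
-- (b = false) depth
leaves : Bool → Tree → ℕ
leaves b leaf       = if b then 1 else 0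
leaves b (node l r) = leaves (not b) l ℕ.+ leaves (not b) r

leaves-total : ∀ b t → leaves b t ℕ.+ leaves (not b) t ≡ suc (size t)
leaves-total true  leaf       = refl
leaves-total false leaf       = refl
leaves-total b     (node l r) = begin
  (leaves b′ l ℕ.+ leaves b′ r) ℕ.+ (leaves (not b′) l ℕ.+ leaves (not b′) r)
    ≡⟨ interchange ℕₚ.+-commutativeSemigroup (leaves b′ l) _ _ _ ⟩
  (leaves b′ l ℕ.+ leaves (not b′) l) ℕ.+ (leaves b′ r ℕ.+ leaves (not b′) r)
    ≡⟨ cong₂ ℕ._+_ (leaves-total b′ l) (leaves-total b′ r) ⟩
  suc (size l) ℕ.+ suc (size r)
    ≡⟨ cong suc (ℕₚ.+-suc (size l) (size r)) ⟩
  suc (size (node l r)) ∎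
  where
  b′ : Bool
  b′ = not b

excess-leaves : ∀ t → + 3 * excess t ≡ + leaves false t - + leaves true t + + 1
excess-leaves leaf       = refl
excess-leaves (node l r) = begin
  + 3 * (+ 1 - excess l - excess r)
    ≡⟨ distrib (excess l) (excess r) ⟩
  + 3 - + 3 * excess l - + 3 * excess r
    ≡⟨ cong₂ (λ x y → + 3 - x - y) (excess-leaves l) (excess-leaves r) ⟩
  + 3 - (+ leaves false l - + leaves true l + + 1) - (+ leaves false r - + leaves true r + + 1)
    ≡⟨ collect (+ leaves false l) (+ leaves true l) (+ leaves false r) (+ leaves true r) ⟩
  (+ leaves true l + + leaves true r) - (+ leaves false l + + leaves false r) + + 1 ∎
  where
  distrib : ∀ a b → + 3 * (+ 1 - a - b) ≡ + 3 - + 3 * a - + 3 * b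
  distrib = solve-∀
  collect : ∀ a b c d → + 3 - (a - b + + 1) - (c - d + + 1) ≡ (b + d) - (a + c) + + 1
  collect = solve-∀

even-leaves : ∀ t → + (2 ℕ.+ size t) - + 3 * excess t ≡ + 2 * + leaves true t
even-leaves t = begin
  + (2 ℕ.+ size t) - + 3 * excess t
    ≡⟨ cong₂ (λ m z → + suc m - z) (sym (leaves-total false t)) (excess-leaves t) ⟩
  + 1 + (+ leaves false t + + leaves true t) - (+ leaves false t - + leaves true t + + 1)
    ≡⟨ cancel (+ leaves false t) (+ leaves true t) ⟩
  + 2 * + leaves true t ∎
  where
  cancel : ∀ a b → + 1 + (a + b) - (a - b + + 1) ≡ + 2 * b
  cancel = solve-∀

-- Triangulations are binary trees.

toTree : ∀ {i j} → Tri i j → Tree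
toTree edge       = leaf
toTree (glue l r) = node (toTree l) (toTree r)

end : Tree → ℕ → ℕ
end leaf       i = suc i
end (node l r) i = end r (end l i)

fromTree : (t : Tree) (i : ℕ) → Tri i (end t i)
fromTree leaf       i = edge
fromTree (node l r) i = glue (fromTree l i) (fromTree r (end l i))

end-size : ∀ t i → end t i ≡ suc (size t ℕ.+ i)
end-size leaf       i = refl
end-size (node l r) i = begin
  end r (end l i)                           ≡⟨ end-size r (end l i) ⟩
  suc (size r ℕ.+ end l i)                  ≡⟨ cong (λ m → suc (size r ℕ.+ m)) (end-size l i) ⟩
  suc (size r ℕ.+ suc (size l ℕ.+ i))       ≡⟨ cong suc (ℕₚ.+-suc (size r) (size l ℕ.+ i)) ⟩
  suc (suc (size r ℕ.+ (size l ℕ.+ i)))     ≡⟨ cong (suc ∘ suc) (ℕₚ.+-assoc (size r) (size l) i) ⟨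
  suc (suc (size r ℕ.+ size l ℕ.+ i))       ≡⟨ cong (λ m → suc (suc (m ℕ.+ i))) (ℕₚ.+-comm (size r) (size l)) ⟩
  suc (size (node l r) ℕ.+ i)               ∎

toTree-fromTree : ∀ t i → toTree (fromTree t i) ≡ t
toTree-fromTree leaf       i = refl
toTree-fromTree (node l r) i = cong₂ node (toTree-fromTree l i) (toTree-fromTree r (end l i))

toTree-subst : ∀ {i j j′} (p : j ≡ j′) (τ : Tri i j) → toTree (subst (Tri i) p τ) ≡ toTree τ
toTree-subst refl τ = refl

fromTree-toTree : ∀ {i j} (τ : Tri i j) →
  _≡_ {A = Σ ℕ (Tri i)} (end (toTree τ) i , fromTree (toTree τ) i) (j , τ)
fromTree-toTree edge = refl
fromTree-toTree {i} (glue {k = k} l r)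
  with end (toTree l) i | fromTree (toTree l) i | fromTree-toTree l
... | _ | _ | refl with end (toTree r) k | fromTree (toTree r) k | fromTree-toTree r
... | _ | _ | refl = refl

Tri↔Tree : ∀ {i j} → Tri i j ↔ Σ Tree (λ t → end t i ≡ j)
Tri↔Tree {i} = mk↔ₛ′
  (λ τ → toTree τ , proj₁ (Σ-≡,≡←≡ (fromTree-toTree τ)))
  (λ (t , p) → subst (Tri i) p (fromTree t i))
  (λ (t , p) → Σ-≡-prop uip (trans (toTree-subst p (fromTree t i)) (toTree-fromTree t i)))
  (λ τ → proj₂ (Σ-≡,≡←≡ (fromTree-toTree τ)))

colour-swap : ∀ {i j} (τ : Tri i j) → nBlack false τ ≡ nWhite true τ × nWhite false τ ≡ nBlack true τ
colour-swap edge       = refl , refl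
colour-swap (glue l r) =
  sym (cong₂ ℕ._+_ (proj₂ (colour-swap l)) (proj₂ (colour-swap r))) ,
  cong suc (sym (cong₂ ℕ._+_ (proj₁ (colour-swap l)) (proj₁ (colour-swap r))))

colour-excess : ∀ {i j} (τ : Tri i j) → + nBlack true τ - + nWhite true τ ≡ excess (toTree τ)
colour-excess edge       = refl
colour-excess (glue l r) = begin
  + suc (nBlack false l ℕ.+ nBlack false r) - + (nWhite false l ℕ.+ nWhite false r)
    ≡⟨ cong₂ (λ a b → + suc a - + b)
         (cong₂ ℕ._+_ (proj₁ (colour-swap l)) (proj₁ (colour-swap r)))
         (cong₂ ℕ._+_ (proj₂ (colour-swap l)) (proj₂ (colour-swap r))) ⟩
  + 1 + (+ nWhite true l + + nWhite true r) - (+ nBlack true l + + nBlack true r)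
    ≡⟨ regroup (+ nBlack true l) (+ nWhite true l) (+ nBlack true r) (+ nWhite true r) ⟩
  + 1 - (+ nBlack true l - + nWhite true l) - (+ nBlack true r - + nWhite true r)
    ≡⟨ cong₂ (λ a b → + 1 - a - b) (colour-excess l) (colour-excess r) ⟩
  + 1 - excess (toTree l) - excess (toTree r) ∎
  where
  regroup : ∀ a b c d → + 1 + (b + d) - (a + c) ≡ + 1 - (a - b) - (c - d)
  regroup = solve-∀

Trees : ℕ → ℤ → Set
Trees n j = Σ Tree (λ t → size t ≡ n × excess t ≡ j)

coefficient↔Trees : ∀ {n j} → Σ (Triangulation n) (λ τ → expo τ ≡ j) ↔ Trees n j
coefficient↔Trees {n} {j} =
  ↔-trans (Σ-↔ Tri↔Tree (λ {τ} → excess↔ τ))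
  (↔-trans Σ-assoc
  (Σ-↔ ↔-refl (λ {t} → end↔size t ×-↔ ↔-refl)))
  where
  excess↔ : (τ : Triangulation n) → (expo τ ≡ j) ↔ (excess (toTree τ) ≡ j)
  excess↔ τ = ≡-prop↔ (trans (sym (colour-excess τ))) (trans (colour-excess τ))
  end-0 : ∀ t → end t 0 ≡ suc (size t)
  end-0 t = trans (end-size t 0) (cong suc (ℕₚ.+-identityʳ (size t)))
  end↔size : ∀ t → (end t 0 ≡ suc n) ↔ (size t ≡ n)
  end↔size t = ≡-prop↔ (λ e → ℕₚ.suc-injective (trans (sym (end-0 t)) e))
                       (λ s → trans (end-0 t) (cong suc s))

-- Zippers and rerooting.  A list of frames is the path from the root of
-- a tree to a marked leaf, each frame recording the direction taken and
-- the subtree left behind.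

data Frame : Set where
  left right : Tree → Frame   -- left r: go left, r is the right sibling

sibling : Frame → Tree
sibling (left t)  = t
sibling (right t) = t

swap : Frame → Frame
swap (left t)  = right t
swap (right t) = left t

sibling-swap : ∀ f → sibling (swap f) ≡ sibling f
sibling-swap (left _)  = refl
sibling-swap (right _) = refl

plug : List Frame → Tree
plug []             = leaf
plug (left r ∷ fs)  = node (plug fs) r
plug (right l ∷ fs) = node l (plug fs)

weight : Frame → ℤ
weight f = + 1 - excess (sibling f)

frameSize : Frame → ℕ
frameSize f = suc (size (sibling f))

plug-excess : ∀ fs → excess (plug fs) ≡ alt (map weight fs)
plug-excess []             = refl
plug-excess (left r ∷ fs)  = begin
  + 1 - excess (plug fs) - excess r     ≡⟨ exchange (excess (plug fs)) (excess r) ⟩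
  (+ 1 - excess r) - excess (plug fs)   ≡⟨ cong (λ z → (+ 1 - excess r) - z) (plug-excess fs) ⟩
  (+ 1 - excess r) - alt (map weight fs) ∎
  where
  exchange : ∀ a b → + 1 - a - b ≡ (+ 1 - b) - a
  exchange = solve-∀
plug-excess (right l ∷ fs) = cong (λ z → + 1 - excess l - z) (plug-excess fs)

plug-size : ∀ fs → size (plug fs) ≡ sum (map frameSize fs)
plug-size []             = refl
plug-size (left r ∷ fs)  = cong suc (trans (ℕₚ.+-comm (size (plug fs)) (size r)) (cong (size r ℕ.+_) (plug-size fs)))
plug-size (right l ∷ fs) = cong suc (cong (size l ℕ.+_) (plug-size fs))

-- Re-hang the tree from its marked leaf: the path back to the old root,
-- with all directions exchanged.
reroot : List Frame → List Frame
reroot fs = reverse (map swap fs)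

map-reroot : ∀ {A : Set} (h : Frame → A) → (∀ f → h (swap f) ≡ h f) →
  ∀ fs → map h (reroot fs) ≡ reverse (map h fs)
map-reroot h h-swap fs = begin
  map h (reverse (map swap fs))  ≡⟨ reverse-map h (map swap fs) ⟩
  reverse (map h (map swap fs))  ≡⟨ cong reverse (map-∘ fs) ⟨
  reverse (map (h ∘ swap) fs)    ≡⟨ cong reverse (map-cong h-swap fs) ⟩
  reverse (map h fs)             ∎

reroot-involutive : ∀ fs → reroot (reroot fs) ≡ fs
reroot-involutive fs = begin
  reverse (map swap (reverse (map swap fs)))  ≡⟨ cong reverse (reverse-map swap (map swap fs)) ⟩
  reverse (reverse (map swap (map swap fs)))  ≡⟨ reverse-involutive _ ⟩
  map swap (map swap fs)                      ≡⟨ map-∘ fs ⟨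
  map (swap ∘ swap) fs                        ≡⟨ map-cong swap-swap fs ⟩
  map (λ f → f) fs                            ≡⟨ map-id fs ⟩
  fs                                          ∎
  where
  swap-swap : ∀ f → swap (swap f) ≡ f
  swap-swap (left _)  = refl
  swap-swap (right _) = refl

reroot-length : ∀ fs → length (reroot fs) ≡ length fs
reroot-length fs = trans (length-reverse (map swap fs)) (length-map swap fs)

reroot-size : ∀ fs → size (plug (reroot fs)) ≡ size (plug fs)
reroot-size fs = begin
  size (plug (reroot fs))        ≡⟨ plug-size (reroot fs) ⟩
  sum (map frameSize (reroot fs)) ≡⟨ cong sum (map-reroot frameSize (cong (suc ∘ size) ∘ sibling-swap) fs) ⟩
  sum (reverse (map frameSize fs)) ≡⟨ sum-↭ (↭-reverse (map frameSize fs)) ⟩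
  sum (map frameSize fs)         ≡⟨ plug-size fs ⟨
  size (plug fs)                 ∎

reroot-excess : ∀ fs → isEven (length fs) ≡ true → excess (plug (reroot fs)) ≡ - excess (plug fs)
reroot-excess fs even = begin
  excess (plug (reroot fs))              ≡⟨ plug-excess (reroot fs) ⟩
  alt (map weight (reroot fs))           ≡⟨ cong alt (map-reroot weight (cong (λ t → + 1 - excess t) ∘ sibling-swap) fs) ⟩
  alt (reverse (map weight fs))          ≡⟨ alt-reverse (map weight fs) ⟩
  - signed (isEven (length (map weight fs))) (alt (map weight fs))
    ≡⟨ cong (λ b → - signed b (alt (map weight fs))) (trans (cong isEven (length-map weight fs)) even) ⟩
  - alt (map weight fs)                  ≡⟨ cong -_ (plug-excess fs) ⟨
  - excess (plug fs)                     ∎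

LeafPath : Bool → Tree → Set
LeafPath b t = Σ (List Frame) (λ fs → isEven (length fs) ≡ b × plug fs ≡ t)

not-transpose : ∀ {x y} → not x ≡ y → x ≡ not y
not-transpose {x} e = trans (sym (not-involutive x)) (cong not e)

rootPath : LeafPath true leaf ↔ Fin 1
rootPath = mk↔ₛ′ (λ _ → Fin.zero) (λ _ → [] , refl , refl) (λ { Fin.zero → refl ; (Fin.suc ()) }) only-root
  where
  only-root : ∀ p → ([] , refl , refl) ≡ p
  only-root ([] , refl , refl)       = refl
  only-root (left _  ∷ _ , _ , ())
  only-root (right _ ∷ _ , _ , ())

noOddRootPath : ¬ LeafPath false leaf
noOddRootPath ([] , () , _)
noOddRootPath (left _  ∷ _ , _ , ())
noOddRootPath (right _ ∷ _ , _ , ())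

nodePaths : ∀ b l r → LeafPath b (node l r) ↔ (LeafPath (not b) l ⊎ LeafPath (not b) r)
nodePaths b l r = mk↔ₛ′ to from to-from from-to
  where
  to : LeafPath b (node l r) → LeafPath (not b) l ⊎ LeafPath (not b) r
  to (left _  ∷ fs , e , refl) = inj₁ (fs , not-transpose e , refl)
  to (right _ ∷ fs , e , refl) = inj₂ (fs , not-transpose e , refl)
  from : LeafPath (not b) l ⊎ LeafPath (not b) r → LeafPath b (node l r)
  from (inj₁ (fs , e , refl)) = left r  ∷ fs , sym (not-transpose (sym e)) , refl
  from (inj₂ (fs , e , refl)) = right l ∷ fs , sym (not-transpose (sym e)) , refl
  to-from : ∀ p → to (from p) ≡ p
  to-from (inj₁ (fs , e , refl)) = cong (λ e′ → inj₁ (fs , e′ , refl)) (uip _ _)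
  to-from (inj₂ (fs , e , refl)) = cong (λ e′ → inj₂ (fs , e′ , refl)) (uip _ _)
  from-to : ∀ p → from (to p) ≡ p
  from-to (left _  ∷ fs , e , refl) = cong (λ e′ → left r  ∷ fs , e′ , refl) (uip _ _)
  from-to (right _ ∷ fs , e , refl) = cong (λ e′ → right l ∷ fs , e′ , refl) (uip _ _)

leafPaths : ∀ b t → LeafPath b t ↔ Fin (leaves b t)
leafPaths true  leaf       = rootPath
leafPaths false leaf       = mk↔ₛ′ (λ p → ⊥-elim (noOddRootPath p)) (λ ()) (λ ()) (λ p → ⊥-elim (noOddRootPath p))
leafPaths b     (node l r) =
  ↔-trans (nodePaths b l r)
  (↔-trans (leafPaths (not b) l ⊎-↔ leafPaths (not b) r)
  (↔-sym Finₚ.+↔⊎))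

Σ-uniform : ∀ {A : Set} {P : A → Set} {b w} → Fin b ↔ A → (∀ x → P x ↔ Fin w) → Σ A P ↔ Fin (b ℕ.* w)
Σ-uniform base fibre =
  ↔-trans (Σ-↔ ↔-refl (λ {x} → fibre x))
  (↔-trans (↔-sym base ×-↔ ↔-refl)
  (↔-sym Finₚ.*↔×))

-- If every fibre has w elements with m·w = c, the total k satisfies
-- m·k = c·b (also when the base is empty and c is not of that form).
count-fibres : ∀ {A : Set} {P : A → Set} {b} (m : ℕ) .{{_ : ℕ.NonZero m}} (c : ℤ) → Fin b ↔ A →
  (∀ x → Σ ℕ (λ w → (P x ↔ Fin w) × + m * + w ≡ c)) →
  Σ ℕ (λ k → (Σ A P ↔ Fin k) × + m * + k ≡ c * + b)
count-fibres {A = A} {b = zero} m c base fibre =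
  0 , mk↔ₛ′ (λ p → ⊥-elim (empty (proj₁ p))) (λ ()) (λ ()) (λ p → ⊥-elim (empty (proj₁ p))) ,
  trans (ℤₚ.*-zeroʳ (+ m)) (sym (ℤₚ.*-zeroʳ c))
  where
  empty : ¬ A
  empty x = Finₚ.¬Fin0 (Inverse.from base x)
count-fibres {A = A} {P} {suc b} m c base fibre =
  suc b ℕ.* w , Σ-uniform base fibre′ , (begin
    + m * + (suc b ℕ.* w)    ≡⟨ cong (+ m *_) (ℤₚ.pos-* (suc b) w) ⟩
    + m * (+ suc b * + w)    ≡⟨ regroup (+ m) (+ suc b) (+ w) ⟩
    (+ m * + w) * + suc b    ≡⟨ cong (_* + suc b) (proj₂ (proj₂ (fibre x₀))) ⟩
    c * + suc b              ∎)
  where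
  x₀ : A
  x₀ = Inverse.to base Fin.zero
  w : ℕ
  w = proj₁ (fibre x₀)
  same-size : ∀ x → proj₁ (fibre x) ≡ w
  same-size x = ℤₚ.+-injective (ℤₚ.*-cancelˡ-≡ (+ m) _ _
    (trans (proj₂ (proj₂ (fibre x))) (sym (proj₂ (proj₂ (fibre x₀))))))
  fibre′ : ∀ x → P x ↔ Fin w
  fibre′ x = subst (λ k → P x ↔ Fin k) (same-size x) (proj₁ (proj₂ (fibre x)))
  regroup : ∀ x y z → x * (y * z) ≡ (x * z) * y
  regroup = solve-∀

-- Trees in Trees n j with a marked leaf at even depth, given by the path
-- to that leaf.
PointedTrees : ℕ → ℤ → Set
PointedTrees n j = Σ (List Frame) (λ fs → isEven (length fs) ≡ true × size (plug fs) ≡ n × excess (plug fs) ≡ j)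

pointed-≡ : ∀ {n j} {p q : PointedTrees n j} → proj₁ p ≡ proj₁ q → p ≡ q
pointed-≡ = Σ-≡-prop (λ (u₁ , u₂ , u₃) (v₁ , v₂ , v₃) → cong₂ _,_ (uip u₁ v₁) (cong₂ _,_ (uip u₂ v₂) (uip u₃ v₃)))

PointedTrees↔fibres : ∀ {n j} → PointedTrees n j ↔ Σ (Trees n j) (λ x → LeafPath true (proj₁ x))
PointedTrees↔fibres = mk↔ₛ′
  (λ (fs , e , s , x) → (plug fs , s , x) , fs , e , refl)
  (λ { ((_ , s , x) , fs , e , refl) → fs , e , s , x })
  (λ { ((_ , s , x) , fs , e , refl) → refl })
  (λ { (fs , e , s , x) → refl })

pointed-count : ∀ {n j b} → Fin b ↔ Trees n j →
  Σ ℕ (λ k → (PointedTrees n j ↔ Fin k) × + 2 * + k ≡ (+ (2 ℕ.+ n) - + 3 * j) * + b)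
pointed-count {n} {j} trees =
  let k , fibres , count = count-fibres 2 (+ (2 ℕ.+ n) - + 3 * j) trees even-paths
  in k , ↔-trans PointedTrees↔fibres fibres , count
  where
  even-paths : ∀ (x : Trees n j) → Σ ℕ (λ w → (LeafPath true (proj₁ x) ↔ Fin w) × + 2 * + w ≡ + (2 ℕ.+ n) - + 3 * j)
  even-paths (t , s , x) = leaves true t , leafPaths true t ,
    trans (sym (even-leaves t)) (cong₂ (λ m z → + (2 ℕ.+ m) - + 3 * z) s x)

reroot-pointed : ∀ {n j j′} → - j ≡ j′ → PointedTrees n j → PointedTrees n j′
reroot-pointed eq (fs , e , s , x) =
  reroot fs , trans (cong isEven (reroot-length fs)) e , trans (reroot-size fs) s ,
  trans (reroot-excess fs e) (trans (cong -_ x) eq)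

reroot↔ : ∀ {n j} → PointedTrees n (- j) ↔ PointedTrees n j
reroot↔ {j = j} = mk↔ₛ′ (reroot-pointed (ℤₚ.neg-involutive j)) (reroot-pointed refl)
  (λ p → pointed-≡ (reroot-involutive (proj₁ p)))
  (λ p → pointed-≡ (reroot-involutive (proj₁ p)))

opposite-excess-count : ∀ {n j k k′} → PointedTrees n (- j) ↔ Fin k → PointedTrees n j ↔ Fin k′ → k ≡ k′
opposite-excess-count pointed₋ pointed₊ = ↔⇒≡ (↔-trans (↔-sym pointed₋) (↔-trans reroot↔ pointed₊))

theorem2p2 : (n : ℕ) (j : ℤ) (a b : ℕ) → CoeffIs n (- j) a → CoeffIs n j b →
    (+ (2 Data.Nat.+ n) + + 3 * j) * + a ≡ (+ (2 Data.Nat.+ n) - + 3 * j) * + b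
theorem2p2 n j a b coeff₋ coeff₊ =
  let k₋ , pointed₋ , count₋ = pointed-count (↔-trans coeff₋ coefficient↔Trees)
      k₊ , pointed₊ , count₊ = pointed-count (↔-trans coeff₊ coefficient↔Trees)
  in begin
  (+ (2 ℕ.+ n) + + 3 * j) * + a      ≡⟨ cong (_* + a) (negate-twice (+ (2 ℕ.+ n)) j) ⟩
  (+ (2 ℕ.+ n) - + 3 * - j) * + a    ≡⟨ count₋ ⟨
  + 2 * + k₋                         ≡⟨ cong (λ k → + 2 * + k) (opposite-excess-count pointed₋ pointed₊) ⟩
  + 2 * + k₊                         ≡⟨ count₊ ⟩
  (+ (2 ℕ.+ n) - + 3 * j) * + b      ∎
  where
  negate-twice : ∀ x y → x + + 3 * y ≡ x - + 3 * - y
  negate-twice = solve-∀
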